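{- For $n\ge2$, $$D_n([1234],[1342],[1423];q)=D_n([1234],[1324],[1423];q)=(n-2)q^{n-2}+q^{n-1}$$ and $$D_n([1324],[1342],[1423];q)=q\cdot\frac{1-q^{n-1}}{1-q}.$$
   Context: For a linear permutation $\pi=\pi_1\ldots\pi_n$ of $[n]$, the cyclic permutation $[\pi]$ is the set of all rotations of $\pi$. A linear permutation $\sigma$ contains $\pi$ if some subsequence of $\sigma$ is order isomorphic to $\pi$. A cyclic permutation $[\sigma]$ contains $[\pi]$ if some rotation of $\sigma$ contains $\pi$; otherwise it avoids $[\pi]$. $\mathrm{Av}_n[\Pi]$ is the set of cyclic permutations of length $n$ avoiding every pattern in the set $[\Pi]$. The cyclic descent number of $[\pi]$ is $\mathrm{cdes}[\pi]=\#\{i\in[n]: \pi_i>\pi_{i+1}\}$ with subscripts taken modulo $n$. $D_n([\Pi];q)=\sum_{[\sigma]\in\mathrm{Av}_n[\Pi]}q^{\mathrm{cdes}[\sigma]}$. -}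

module Defs where

open import Data.Nat using (ℕ; zero; suc; _+_; _∸_; _<ᵇ_; _≡ᵇ_)
open import Data.Bool using (Bool; true; false; _∧_; _∨_; if_then_else_; not)
open import Data.List using (List; []; _∷_; _++_; map; concatMap; length; upTo; take; drop; zipWith; filterᵇ)
open import Data.Bool.ListAction using (all; any; and)

-- Linear permutations of [n] are lists containing each of 0,…,n-1 exactly once
-- (values are 0-based; only relative order matters for patterns and cdes).

insertions : ℕ → List ℕ → List (List ℕ)
insertions x [] = (x ∷ []) ∷ []
insertions x (y ∷ ys) = (x ∷ y ∷ ys) ∷ map (y ∷_) (insertions x ys)

perms : ℕ → List (List ℕ)
perms zero = [] ∷ []
perms (suc n) = concatMap (insertions n) (perms n)

subseqs : List ℕ → List (List ℕ)
subseqs [] = [] ∷ []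
subseqs (x ∷ xs) = map (x ∷_) (subseqs xs) ++ subseqs xs

orderIso : List ℕ → List ℕ → Bool
orderIso [] [] = true
orderIso [] (_ ∷ _) = false
orderIso (_ ∷ _) [] = false
orderIso (x ∷ xs) (y ∷ ys) =
  and (zipWith (λ x′ y′ → (x <ᵇ x′) ≡ᵇ′ (y <ᵇ y′)) xs ys) ∧ orderIso xs ys
  where
  _≡ᵇ′_ : Bool → Bool → Bool
  true ≡ᵇ′ b = b
  false ≡ᵇ′ b = not b

contains : List ℕ → List ℕ → Bool
contains σ π = any (orderIso π) (subseqs σ)

rotations : List ℕ → List (List ℕ)
rotations σ = map (λ i → drop i σ ++ take i σ) (upTo (length σ))

cycContains : List ℕ → List ℕ → Bool
cycContains σ π = any (λ ρ → contains ρ π) (rotations σ)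

cycAvoidsAll : List (List ℕ) → List ℕ → Bool
cycAvoidsAll Π σ = all (λ π → not (cycContains σ π)) Π

cdes : List ℕ → ℕ
cdes [] = 0
cdes (x ∷ xs) = length (filterᵇ (λ b → b) (zipWith (λ a b → b <ᵇ a) (x ∷ xs) (xs ++ x ∷ [])))

startsWith0 : List ℕ → Bool
startsWith0 [] = false
startsWith0 (x ∷ _) = x ≡ᵇ 0

-- Cyclic permutations of length n (n ≥ 1): each class [σ] contains exactly one
-- rotation beginning with the minimum value 0; we use that rotation as the
-- representative of the class.
cycPerms : ℕ → List (List ℕ)
cycPerms n = filterᵇ startsWith0 (perms n)

-- Coefficient of q^k in D_n([Π]; q)
Dcoeff : List (List ℕ) → ℕ → ℕ → ℕ
Dcoeff Π n k = length (filterᵇ (λ σ → cycAvoidsAll Π σ ∧ (cdes σ ≡ᵇ k)) (cycPerms n))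

-- patterns (1-based as in the paper; only relative order matters)
p1234 p1342 p1423 p1324 : List ℕ
p1234 = 1 ∷ 2 ∷ 3 ∷ 4 ∷ []
p1342 = 1 ∷ 3 ∷ 4 ∷ 2 ∷ []
p1423 = 1 ∷ 4 ∷ 2 ∷ 3 ∷ []
p1324 = 1 ∷ 3 ∷ 2 ∷ 4 ∷ []

-- coefficient of q^k in (n-2) q^{n-2} + q^{n-1}
rhsA : ℕ → ℕ → ℕ
rhsA n k = (if k ≡ᵇ (n ∸ 2) then n ∸ 2 else 0) + (if k ≡ᵇ (n ∸ 1) then 1 else 0)

-- coefficient of q^k in q (1 - q^{n-1}) / (1 - q) = q + q^2 + … + q^{n-1}
rhsB : ℕ → ℕ → ℕ
rhsB n k = if (0 <ᵇ k) ∧ (k <ᵇ n) then 1 else 0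

{-# OPTIONS --safe #-}
module Submission where

-- Normalise a cyclic permutation by rotating 0 to the front. Deleting the maximum of an avoider
-- leaves an avoider, so the avoiders of length n + 1 arise by inserting n into those of length n.
-- For each triple of patterns the avoiders form an explicit two-parameter family (0 followed by
-- monotone runs), and inserting the maximum into a member of the family either gives another
-- member or creates one of the patterns on an explicit subsequence of length four. A member avoids
-- the patterns because a subsequence of length at most four meets each monotone run in at most four
-- entries, so it is matched, with the same relative order and compatibly with rotation, by a
-- subsequence of one fixed member of length 9 or 10, whose avoidance is checked by evaluation.
-- Counting cyclic descents along each family gives the polynomials.

open import Defs
open import Data.Bool using (Bool; true; false; T; not; _∧_; if_then_else_)
open import Data.Bool.Properties using (T-∧; ∧-assoc)
open import Data.Bool.ListAction using (any)
open import Data.Empty using (⊥-elim)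
open import Data.List
  using (List; []; _∷_; _++_; [_]; map; concat; concatMap; length; zipWith; zip; take; drop;
         filterᵇ; applyUpTo; applyDownFrom; replicate)
open import Data.List.Properties
  using (map-++; map-∘; map-id; map-cong; map-cong-local; concatMap-map; map-concatMap; concatMap-++;
         applyUpTo-∷ʳ; filter-accept; filter-reject; filter-none; filter-++; filter-≐; ++-identityʳ;
         ++-assoc; length-++; length-++-≤ˡ; length-++-≤ʳ; length-++-comm; length-map; length-take;
         take++drop≡id; ∷-injective)
open import Data.List.Membership.Propositional using (_∈_; find; lose)
open import Data.List.Membership.Propositional.Properties
  using (∈-map⁺; ∈-map⁻; ∈-++⁺ˡ; ∈-++⁺ʳ; ∈-++⁻; ∈-upTo⁺; ∈-applyUpTo⁻; ∈-applyDownFrom⁻)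
open import Data.List.Relation.Unary.All as All using (All; []; _∷_)
open import Data.List.Relation.Unary.All.Properties
  using (all⁺; all⁻; All-swap) renaming (map⁻ to All-map⁻; ++⁺ to All-++⁺; ++⁻ to All-++⁻)
open import Data.List.Relation.Unary.AllPairs using (AllPairs; []; _∷_)
import Data.List.Relation.Unary.AllPairs.Properties as AllPairs
open import Data.List.Relation.Unary.Any using (here; there)
open import Data.List.Relation.Unary.Any.Properties using (any⁺; any⁻)
open import Data.List.Relation.Binary.Sublist.Propositional
  using (_⊆_; []; _∷_; _∷ʳ_; ⊆-refl; ⊆-trans; minimum; lookup)
open import Data.List.Relation.Binary.Sublist.Propositional.Properties
  using (++⁺; ++⁺ˡ; ++⁺ʳ; take-⊆; All-resp-⊆; length-mono-≤)
open import Data.Nat using (ℕ; zero; suc; _+_; _<_; _>_; _≤_; _<ᵇ_; _≡ᵇ_; z≤n; s≤s; z<s; s<s)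
open import Data.Nat.Properties
  using (<⇒<ᵇ; <ᵇ⇒<; ≤⇒≯; <⇒≤; ≤-refl; ≤-reflexive; ≤-trans; <-trans; <-≤-trans; n<1+n; m<n⇒m<1+n;
         m≤m+n; m≤n⇒m⊓n≡m; +-comm; +-suc; +-identityʳ; +-monoʳ-<)
open import Data.Product using (∃; ∃₂; _×_; _,_; proj₁; proj₂; uncurry; map₂)
open import Data.Sum using (_⊎_; inj₁; inj₂)
open import Function using (_∘_; id; Equivalence)
open import Level using (Level)
open import Relation.Binary.Definitions using (Symmetric)
open import Relation.Binary.PropositionalEquality
  using (_≡_; refl; sym; trans; cong; cong₂; subst; module ≡-Reasoning)
open import Relation.Nullary using (¬_; contradiction)
open import Relation.Nullary.Decidable using (T?)

private
  variable
    ℓ : Level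
    A B : Set
    R S S′ : ℕ → ℕ → Set
    a i j k x y : ℕ
    xs ys t σ τ τ* π : List ℕ
    Π : List (List ℕ)

AllPairs-resp-⊆ : ∀ {R : A → A → Set ℓ} {xs ys} → ys ⊆ xs → AllPairs R xs → AllPairs R ys
AllPairs-resp-⊆ [] ps = ps
AllPairs-resp-⊆ (_ ∷ʳ s) (_ ∷ ps) = AllPairs-resp-⊆ s ps
AllPairs-resp-⊆ (refl ∷ s) (p ∷ ps) = All-resp-⊆ s p ∷ AllPairs-resp-⊆ s ps

AllPairs-++⁻ : ∀ {R : A → A → Set ℓ} xs {ys} → AllPairs R (xs ++ ys) →
  AllPairs R xs × AllPairs R ys × All (λ x → All (R x) ys) xs
AllPairs-++⁻ [] ps = [] , ps , []
AllPairs-++⁻ (x ∷ xs) (p ∷ ps) with All-++⁻ xs p | AllPairs-++⁻ xs ps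
... | pxs′ , pys′ | pxs , pys , cross = pxs′ ∷ pxs , pys , pys′ ∷ cross

AllPairs-++-comm : ∀ {R : A → A → Set ℓ} → Symmetric R → ∀ xs {ys} →
  AllPairs R (xs ++ ys) → AllPairs R (ys ++ xs)
AllPairs-++-comm sym-R xs ps with AllPairs-++⁻ xs ps
... | pxs , pys , cross = AllPairs.++⁺ pys pxs (All.map (All.map sym-R) (All-swap cross))

All-zip : ∀ {P : A → Set} {Q : B → Set} {xs ys} → All P xs → All Q ys →
  All (λ (x , y) → P x × Q y) (zip xs ys)
All-zip [] _ = []
All-zip (_ ∷ _) [] = []
All-zip (p ∷ ps) (q ∷ qs) = (p , q) ∷ All-zip ps qs

AllPairs-zip : ∀ {P : A → A → Set} {Q : B → B → Set} {U : A × B → A × B → Set} {xs ys} →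
  (∀ {x x′ y y′} → P x x′ → Q y y′ → U (x , y) (x′ , y′)) →
  AllPairs P xs → AllPairs Q ys → AllPairs U (zip xs ys)
AllPairs-zip f [] _ = []
AllPairs-zip f (_ ∷ _) [] = []
AllPairs-zip f (p ∷ ps) (q ∷ qs) = All.map (uncurry f) (All-zip p q) ∷ AllPairs-zip f ps qs

map-proj₁-zip : ∀ {xs : List A} {ys : List B} → length xs ≤ length ys → map proj₁ (zip xs ys) ≡ xs
map-proj₁-zip {xs = []} _ = refl
map-proj₁-zip {xs = x ∷ _} {_ ∷ _} (s≤s le) = cong (x ∷_) (map-proj₁-zip le)

map-proj₂-zip : ∀ {xs : List A} {ys : List B} → length ys ≤ length xs → map proj₂ (zip xs ys) ≡ ys
map-proj₂-zip {xs = []} {[]} _ = refl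
map-proj₂-zip {xs = _ ∷ _} {[]} _ = refl
map-proj₂-zip {xs = _ ∷ _} {y ∷ _} (s≤s le) = cong (y ∷_) (map-proj₂-zip le)

map-++⁻ : ∀ (f : A → B) W {xs ys} → map f W ≡ xs ++ ys →
  ∃₂ λ W₁ W₂ → W ≡ W₁ ++ W₂ × map f W₁ ≡ xs × map f W₂ ≡ ys
map-++⁻ f W {[]} e = [] , W , refl , refl , e
map-++⁻ f (w ∷ W) {_ ∷ _} e with ∷-injective e
... | refl , e′ with map-++⁻ f W e′
...   | W₁ , W₂ , refl , e₁ , e₂ = w ∷ W₁ , W₂ , refl , cong (f w ∷_) e₁ , e₂

map-const-local : ∀ (f : A → B) {v} xs → (∀ {x} → x ∈ xs → f x ≡ v) → map f xs ≡ replicate (length xs) v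
map-const-local f [] _ = refl
map-const-local f (x ∷ xs) fx≡v = cong₂ _∷_ (fx≡v (here refl)) (map-const-local f xs (fx≡v ∘ there))

⊆-++-split : ∀ xs → t ⊆ xs ++ ys → ∃₂ λ u v → t ≡ u ++ v × u ⊆ xs × v ⊆ ys
⊆-++-split [] s = [] , _ , refl , [] , s
⊆-++-split (x ∷ xs) (_ ∷ʳ s) with ⊆-++-split xs s
... | u , v , refl , su , sv = u , v , refl , x ∷ʳ su , sv
⊆-++-split (x ∷ xs) (refl ∷ s) with ⊆-++-split xs s
... | u , v , refl , su , sv = x ∷ u , v , refl , refl ∷ su , sv

++-⊆-split : ∀ xs → xs ++ ys ⊆ σ → ∃₂ λ σ₁ σ₂ → σ ≡ σ₁ ++ σ₂ × xs ⊆ σ₁ × ys ⊆ σ₂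
++-⊆-split [] s = [] , _ , refl , [] , s
++-⊆-split xs (y ∷ʳ s) with ++-⊆-split xs s
... | σ₁ , σ₂ , refl , s₁ , s₂ = y ∷ σ₁ , σ₂ , refl , y ∷ʳ s₁ , s₂
++-⊆-split (x ∷ xs) (refl ∷ s) with ++-⊆-split xs s
... | σ₁ , σ₂ , refl , s₁ , s₂ = x ∷ σ₁ , σ₂ , refl , refl ∷ s₁ , s₂

filterᵇ-filterᵇ : ∀ (p q : A → Bool) xs → filterᵇ q (filterᵇ p xs) ≡ filterᵇ (λ x → p x ∧ q x) xs
filterᵇ-filterᵇ p q [] = refl
filterᵇ-filterᵇ p q (x ∷ xs) with p x
... | false = filterᵇ-filterᵇ p q xs
... | true with q x
...   | true = cong (x ∷_) (filterᵇ-filterᵇ p q xs)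
...   | false = filterᵇ-filterᵇ p q xs

filterᵇ-cong : ∀ {p q : A → Bool} → (∀ x → p x ≡ q x) → ∀ xs → filterᵇ p xs ≡ filterᵇ q xs
filterᵇ-cong {p = p} {q} p≗q =
  filter-≐ (T? ∘ p) (T? ∘ q) ((λ {x} → subst T (p≗q x)) , (λ {x} → subst T (sym (p≗q x))))

filterᵇ-map : ∀ (p : B → Bool) (f : A → B) xs → filterᵇ p (map f xs) ≡ map f (filterᵇ (p ∘ f) xs)
filterᵇ-map p f [] = refl
filterᵇ-map p f (x ∷ xs) with p (f x)
... | true = cong (f x ∷_) (filterᵇ-map p f xs)
... | false = filterᵇ-map p f xs

filterᵇ-none : ∀ {p : A → Bool} {xs} → (∀ {x} → x ∈ xs → ¬ T (p x)) → filterᵇ p xs ≡ []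
filterᵇ-none {p = p} bad = filter-none (T? ∘ p) (All.tabulate bad)

filterᵇ-concatMap : ∀ (p : B → Bool) (f : A → List B) xs →
  filterᵇ p (concatMap f xs) ≡ concatMap (filterᵇ p ∘ f) xs
filterᵇ-concatMap p f [] = refl
filterᵇ-concatMap p f (x ∷ xs) =
  trans (filter-++ (T? ∘ p) (f x) (concatMap f xs)) (cong (filterᵇ p (f x) ++_) (filterᵇ-concatMap p f xs))

concatMap-filterᵇ : ∀ (p : A → Bool) (f : A → List B) → (∀ x → ¬ T (p x) → f x ≡ []) →
  ∀ xs → concatMap f xs ≡ concatMap f (filterᵇ p xs)
concatMap-filterᵇ p f vanish [] = refl
concatMap-filterᵇ p f vanish (x ∷ xs) with p x in eq
... | true = cong (f x ++_) (concatMap-filterᵇ p f vanish xs)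
... | false = trans (cong (_++ concatMap f xs) (vanish x (subst T eq))) (concatMap-filterᵇ p f vanish xs)

length-filterᵇ-∷ : ∀ (p : A → Bool) x xs →
  length (filterᵇ p (x ∷ xs)) ≡ (if p x then 1 else 0) + length (filterᵇ p xs)
length-filterᵇ-∷ p x xs with p x
... | true = refl
... | false = refl

<ᵇ-true : ∀ {m n} → m < n → (m <ᵇ n) ≡ true
<ᵇ-true {m} {n} m<n with m <ᵇ n | <⇒<ᵇ m<n
... | true | _ = refl

<ᵇ-false : ∀ {m n} → n ≤ m → (m <ᵇ n) ≡ false
<ᵇ-false {m} {n} n≤m with m <ᵇ n in eq
... | false = refl
... | true = contradiction (<ᵇ⇒< m n (subst T (sym eq) _)) (≤⇒≯ n≤m)

T-not⁻ : ∀ {b} → T (not b) → ¬ T b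
T-not⁻ {false} _ ()

T-not⁺ : ∀ {b} → ¬ T b → T (not b)
T-not⁺ {true} ¬b = ¬b _
T-not⁺ {false} _ = _

≡ᵇ-comm : ∀ m n → (m ≡ᵇ n) ≡ (n ≡ᵇ m)
≡ᵇ-comm zero zero = refl
≡ᵇ-comm zero (suc n) = refl
≡ᵇ-comm (suc m) zero = refl
≡ᵇ-comm (suc m) (suc n) = ≡ᵇ-comm m n

record Agree (x y : ℕ × ℕ) : Set where
  constructor agree
  field
    forward  : (proj₁ x <ᵇ proj₁ y) ≡ (proj₂ x <ᵇ proj₂ y)
    backward : (proj₁ y <ᵇ proj₁ x) ≡ (proj₂ y <ᵇ proj₂ x)

Agree-sym : Symmetric Agree
Agree-sym (agree e e′) = agree e′ e

agree-< : ∀ {x₁ x₂ y₁ y₂} → x₁ < y₁ → x₂ < y₂ → Agree (x₁ , x₂) (y₁ , y₂)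
agree-< p q = agree (trans (<ᵇ-true p) (sym (<ᵇ-true q)))
                    (trans (<ᵇ-false (<⇒≤ p)) (sym (<ᵇ-false (<⇒≤ q))))

agree-> : ∀ {x₁ x₂ y₁ y₂} → y₁ < x₁ → y₂ < x₂ → Agree (x₁ , x₂) (y₁ , y₂)
agree-> p q = Agree-sym (agree-< p q)

agree-<ᵇ : ∀ {x₁ x₂ y₁ y₂} → x₁ < y₁ → T (x₂ <ᵇ y₂) → Agree (x₁ , x₂) (y₁ , y₂)
agree-<ᵇ p q = agree-< p (<ᵇ⇒< _ _ q)

agree->ᵇ : ∀ {x₁ x₂ y₁ y₂} → y₁ < x₁ → T (y₂ <ᵇ x₂) → Agree (x₁ , x₂) (y₁ , y₂)
agree->ᵇ p q = agree-> p (<ᵇ⇒< _ _ q)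

data Pattern : List ℕ → Set where
  pattern1234 : Pattern p1234
  pattern1342 : Pattern p1342
  pattern1423 : Pattern p1423
  pattern1324 : Pattern p1324

length-orderIso : ∀ π t → T (orderIso π t) → length π ≡ length t
length-orderIso [] [] _ = refl
length-orderIso (_ ∷ π) (_ ∷ t) iso = cong suc (length-orderIso π t (proj₂ (Equivalence.to T-∧ iso)))

length-pattern : Pattern π → length π ≡ 4
length-pattern pattern1234 = refl
length-pattern pattern1342 = refl
length-pattern pattern1423 = refl
length-pattern pattern1324 = refl

nonempty-patterns : All Pattern Π → All (λ π → 0 < length π) Π
nonempty-patterns = All.map (λ P → subst (0 <_) (sym (length-pattern P)) z<s)

orderIso-agree : Pattern π → ∀ W → length W ≡ 4 → AllPairs Agree W →
  orderIso π (map proj₁ W) ≡ orderIso π (map proj₂ W)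
orderIso-agree P (_ ∷ _ ∷ _ ∷ _ ∷ []) refl
  ( (agree e₁₂ _ ∷ agree e₁₃ _ ∷ agree e₁₄ _ ∷ [])
  ∷ (agree e₂₃ _ ∷ agree e₂₄ _ ∷ [])
  ∷ (agree e₃₄ _ ∷ [])
  ∷ [] ∷ [])
  with P
... | pattern1234 rewrite e₁₂ | e₁₃ | e₁₄ | e₂₃ | e₂₄ | e₃₄ = refl
... | pattern1342 rewrite e₁₂ | e₁₃ | e₁₄ | e₂₃ | e₂₄ | e₃₄ = refl
... | pattern1423 rewrite e₁₂ | e₁₃ | e₁₄ | e₂₃ | e₂₄ | e₃₄ = refl
... | pattern1324 rewrite e₁₂ | e₁₃ | e₁₄ | e₂₃ | e₂₄ | e₃₄ = refl

-- Compare with the pattern itself, for which orderIso evaluates to true.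
orderIso-by-agree : ∀ {a b c d} → Pattern π → AllPairs Agree (zip (a ∷ b ∷ c ∷ d ∷ []) π) →
  T (orderIso π (a ∷ b ∷ c ∷ d ∷ []))
orderIso-by-agree pattern1234 ap = subst T (sym (orderIso-agree pattern1234 _ refl ap)) _
orderIso-by-agree pattern1342 ap = subst T (sym (orderIso-agree pattern1342 _ refl ap)) _
orderIso-by-agree pattern1423 ap = subst T (sym (orderIso-agree pattern1423 _ refl ap)) _
orderIso-by-agree pattern1324 ap = subst T (sym (orderIso-agree pattern1324 _ refl ap)) _

orderIso-1234 : ∀ {a b c d} → a < b → b < c → c < d → T (orderIso p1234 (a ∷ b ∷ c ∷ d ∷ []))
orderIso-1234 {a} {b} {c} {d} ab bc cd = orderIso-by-agree pattern1234
  ( (agree-<ᵇ ab _ ∷ agree-<ᵇ ac _ ∷ agree-<ᵇ (<-trans ac cd) _ ∷ [])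
  ∷ (agree-<ᵇ bc _ ∷ agree-<ᵇ bd _ ∷ [])
  ∷ (agree-<ᵇ cd _ ∷ [])
  ∷ [] ∷ [])
  where
  ac : a < c
  ac = <-trans ab bc
  bd : b < d
  bd = <-trans bc cd

orderIso-1342 : ∀ {a b c d} → a < d → d < b → b < c → T (orderIso p1342 (a ∷ b ∷ c ∷ d ∷ []))
orderIso-1342 {a} {b} ad db bc = orderIso-by-agree pattern1342
  ( (agree-<ᵇ ab _ ∷ agree-<ᵇ (<-trans ab bc) _ ∷ agree-<ᵇ ad _ ∷ [])
  ∷ (agree-<ᵇ bc _ ∷ agree->ᵇ db _ ∷ [])
  ∷ (agree->ᵇ (<-trans db bc) _ ∷ [])
  ∷ [] ∷ [])
  where
  ab : a < b
  ab = <-trans ad db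

orderIso-1423 : ∀ {a b c d} → a < c → c < d → d < b → T (orderIso p1423 (a ∷ b ∷ c ∷ d ∷ []))
orderIso-1423 {a} {d = d} ac cd db = orderIso-by-agree pattern1423
  ( (agree-<ᵇ (<-trans ad db) _ ∷ agree-<ᵇ ac _ ∷ agree-<ᵇ ad _ ∷ [])
  ∷ (agree->ᵇ (<-trans cd db) _ ∷ agree->ᵇ db _ ∷ [])
  ∷ (agree-<ᵇ cd _ ∷ [])
  ∷ [] ∷ [])
  where
  ad : a < d
  ad = <-trans ac cd

orderIso-1324 : ∀ {a b c d} → a < c → c < b → b < d → T (orderIso p1324 (a ∷ b ∷ c ∷ d ∷ []))
orderIso-1324 {c = c} {d} ac cb bd = orderIso-by-agree pattern1324
  ( (agree-<ᵇ (<-trans ac cb) _ ∷ agree-<ᵇ ac _ ∷ agree-<ᵇ (<-trans ac cd) _ ∷ [])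
  ∷ (agree->ᵇ cb _ ∷ agree-<ᵇ bd _ ∷ [])
  ∷ (agree-<ᵇ cd _ ∷ [])
  ∷ [] ∷ [])
  where
  cd : c < d
  cd = <-trans cb bd

∈-subseqs⁺ : xs ⊆ ys → xs ∈ subseqs ys
∈-subseqs⁺ [] = here refl
∈-subseqs⁺ {ys = y ∷ ys} (_ ∷ʳ s) = ∈-++⁺ʳ (map (y ∷_) (subseqs ys)) (∈-subseqs⁺ s)
∈-subseqs⁺ (refl ∷ s) = ∈-++⁺ˡ (∈-map⁺ (_ ∷_) (∈-subseqs⁺ s))

∈-subseqs⁻ : ∀ ys → xs ∈ subseqs ys → xs ⊆ ys
∈-subseqs⁻ [] (here refl) = []
∈-subseqs⁻ (y ∷ ys) m with ∈-++⁻ (map (y ∷_) (subseqs ys)) m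
... | inj₂ m′ = y ∷ʳ ∈-subseqs⁻ ys m′
... | inj₁ m′ with ∈-map⁻ (y ∷_) m′
...   | _ , m″ , refl = refl ∷ ∈-subseqs⁻ ys m″

++-comm-∈-rotations : ∀ xs ys → 0 < length ys → ys ++ xs ∈ rotations (xs ++ ys)
++-comm-∈-rotations xs ys ys≢[] =
  subst (_∈ rotations (xs ++ ys)) (cong₂ _++_ (drop-length-++ xs) (take-length-++ xs))
    (∈-map⁺ (λ i → drop i (xs ++ ys) ++ take i (xs ++ ys)) (∈-upTo⁺ (length-< xs)))
  where
  drop-length-++ : ∀ xs → drop (length xs) (xs ++ ys) ≡ ys
  drop-length-++ [] = refl
  drop-length-++ (_ ∷ xs) = drop-length-++ xs
  take-length-++ : ∀ xs → take (length xs) (xs ++ ys) ≡ xs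
  take-length-++ [] = refl
  take-length-++ (x ∷ xs) = cong (x ∷_) (take-length-++ xs)
  length-< : ∀ xs → length xs < length (xs ++ ys)
  length-< [] = ys≢[]
  length-< (_ ∷ xs) = s≤s (length-< xs)

swap-⊆-rotation : 0 < length (ys ++ xs) → xs ++ ys ⊆ σ → ∃ λ ρ → ρ ∈ rotations σ × ys ++ xs ⊆ ρ
swap-⊆-rotation {[]} {xs} {σ} pos s =
  σ ++ [] , ++-comm-∈-rotations [] σ (<-≤-trans pos (length-mono-≤ xs⊆σ)) , ++⁺ʳ [] xs⊆σ
  where
  xs⊆σ : xs ⊆ σ
  xs⊆σ = subst (_⊆ σ) (++-identityʳ xs) s
swap-⊆-rotation {_ ∷ _} {xs} pos s with ++-⊆-split xs s
... | σ₁ , σ₂ , refl , s₁ , s₂ =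
  σ₂ ++ σ₁ , ++-comm-∈-rotations σ₁ σ₂ (<-≤-trans z<s (length-mono-≤ s₂)) , ++⁺ s₂ s₁

CyclicOccurrence : List ℕ → List ℕ → Set
CyclicOccurrence π σ = ∃₂ λ xs ys → xs ++ ys ⊆ σ × T (orderIso π (ys ++ xs))

cycContains⇒occurrence : T (cycContains σ π) → CyclicOccurrence π σ
cycContains⇒occurrence {σ} {π} c with find (any⁻ (λ ρ → contains ρ π) (rotations σ) c)
... | ρ , ρ∈ , cρ
    with ∈-map⁻ (λ i → drop i σ ++ take i σ) ρ∈ | find (any⁻ (orderIso π) (subseqs ρ) cρ)
... | i , _ , refl | t , t∈ , iso with ⊆-++-split (drop i σ) (∈-subseqs⁻ _ t∈)
... | ys , xs , refl , sys , sxs = xs , ys , subst (xs ++ ys ⊆_) (take++drop≡id i σ) (++⁺ sxs sys) , iso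

occurrence⇒cycContains : 0 < length π → CyclicOccurrence π σ → T (cycContains σ π)
occurrence⇒cycContains {π} {σ} π≢[] (xs , ys , s , iso)
  with swap-⊆-rotation {ys} {xs} (subst (0 <_) (length-orderIso π _ iso) π≢[]) s
... | ρ , ρ∈ , s′ = any⁺ (λ ρ → contains ρ π) (lose ρ∈ (any⁺ (orderIso π) (lose (∈-subseqs⁺ s′) iso)))

cycContains-⊆ : 0 < length π → σ ⊆ τ → T (cycContains σ π) → T (cycContains τ π)
cycContains-⊆ {π} π≢[] σ⊆τ c with cycContains⇒occurrence {π = π} c
... | xs , ys , s , iso = occurrence⇒cycContains {π} π≢[] (xs , ys , ⊆-trans s σ⊆τ , iso)

cycContains-subsequence : 0 < length π → t ⊆ σ → T (orderIso π t) → T (cycContains σ π)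
cycContains-subsequence {π} {t} π≢[] s iso =
  occurrence⇒cycContains {π} π≢[] ([] , t , s , subst (T ∘ orderIso π) (sym (++-identityʳ t)) iso)

cycContains⇒¬cycAvoidsAll : ∀ {π Π σ} → π ∈ Π → T (cycContains σ π) → ¬ T (cycAvoidsAll Π σ)
cycContains⇒¬cycAvoidsAll {Π = Π} {σ} π∈Π c av =
  T-not⁻ (All.lookup (all⁺ (not ∘ cycContains σ) Π av) π∈Π) c

cycAvoidsAll-⊆ : All (λ π → 0 < length π) Π → σ ⊆ τ → T (cycAvoidsAll Π τ) → T (cycAvoidsAll Π σ)
cycAvoidsAll-⊆ {Π} {σ} {τ} nonempty σ⊆τ av = all⁻ (not ∘ cycContains σ)
  (All.zipWith (λ {π} → avoid {π}) (nonempty , all⁺ (not ∘ cycContains τ) Π av))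
  where
  avoid : ∀ {π} → 0 < length π × T (not (cycContains τ π)) → T (not (cycContains σ π))
  avoid {π} (π≢[] , a) = T-not⁺ (T-not⁻ a ∘ cycContains-⊆ {π} π≢[] σ⊆τ)

-- Collapsing onto a short representative

-- R tracks which blocks matched values come from; collapse-++ needs it to compare values taken
-- from different blocks.
CollapseVia : (ℕ → ℕ → Set) → List ℕ → List ℕ → Set
CollapseVia R τ τ* = ∀ {t} → t ⊆ τ → length t ≤ 4 →
  ∃ λ W → map proj₁ W ≡ t × map proj₂ W ⊆ τ* × AllPairs Agree W × All (uncurry R) W

Collapse : List ℕ → List ℕ → Set₁
Collapse τ τ* = ∃ λ R → CollapseVia R τ τ*

collapse-cycContains : Pattern π → Collapse τ τ* → T (cycContains τ π) → T (cycContains τ* π)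
collapse-cycContains {π} P (_ , col) c with cycContains⇒occurrence {π = π} c
... | xs , ys , s , iso with col s (≤-reflexive length-xs++ys)
  where
  length-xs++ys : length (xs ++ ys) ≡ 4
  length-xs++ys = trans (length-++-comm xs ys) (trans (sym (length-orderIso π _ iso)) (length-pattern P))
... | W , e , s* , agreeW , _ with map-++⁻ proj₁ W {xs} {ys} e
...   | Wx , Wy , refl , refl , refl =
  occurrence⇒cycContains {π} (subst (0 <_) (sym (length-pattern P)) z<s)
    (map proj₂ Wx , map proj₂ Wy , subst (_⊆ _) (map-++ proj₂ Wx Wy) s* , iso*)
  where
  length-Wy++Wx : length (Wy ++ Wx) ≡ 4
  length-Wy++Wx = trans (sym (length-map proj₁ (Wy ++ Wx)))
    (trans (cong length (map-++ proj₁ Wy Wx)) (trans (sym (length-orderIso π _ iso)) (length-pattern P)))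
  swapped : orderIso π (map proj₁ (Wy ++ Wx)) ≡ orderIso π (map proj₂ (Wy ++ Wx))
  swapped = orderIso-agree P (Wy ++ Wx) length-Wy++Wx (AllPairs-++-comm Agree-sym Wx agreeW)
  iso* : T (orderIso π (map proj₂ Wy ++ map proj₂ Wx))
  iso* = subst T (trans swapped (cong (orderIso π) (map-++ proj₂ Wy Wx)))
    (subst (T ∘ orderIso π) (sym (map-++ proj₁ Wy Wx)) iso)

cycAvoidsAll-collapse : All Pattern Π → Collapse τ τ* → T (cycAvoidsAll Π τ*) → T (cycAvoidsAll Π τ)
cycAvoidsAll-collapse {Π} {τ} {τ*} patterns col av = all⁻ (not ∘ cycContains τ)
  (All.zipWith (λ {π} → avoid {π}) (patterns , all⁺ (not ∘ cycContains τ*) Π av))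
  where
  avoid : ∀ {π} → Pattern π × T (not (cycContains τ* π)) → T (not (cycContains τ π))
  avoid (P , a) = T-not⁺ (T-not⁻ a ∘ collapse-cycContains P col)

Cross : (ℕ → ℕ → Set) → (ℕ → ℕ → Set) → Set
Cross R S = ∀ {x x* y y*} → R x x* → S y y* → Agree (x , x*) (y , y*)

cross-⊎ : Cross R S → Cross R S′ → Cross R (λ y y* → S y y* ⊎ S′ y y*)
cross-⊎ c c′ r (inj₁ s) = c r s
cross-⊎ c c′ r (inj₂ s) = c′ r s

collapse-++ : ∀ {τ₁ τ₂ τ₁* τ₂*} → CollapseVia R τ₁ τ₁* → CollapseVia S τ₂ τ₂* → Cross R S →
  CollapseVia (λ x x* → R x x* ⊎ S x x*) (τ₁ ++ τ₂) (τ₁* ++ τ₂*)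
collapse-++ {τ₁ = τ₁} {τ₁* = τ₁*} {τ₂*} col₁ col₂ cross s len with ⊆-++-split τ₁ s
... | u , v , refl , su , sv
    with col₁ su (≤-trans (length-++-≤ˡ u) len) | col₂ sv (≤-trans (length-++-≤ʳ v {u}) len)
... | W₁ , refl , s₁ , agree₁ , R₁ | W₂ , refl , s₂ , agree₂ , R₂ =
  W₁ ++ W₂ ,
  map-++ proj₁ W₁ W₂ ,
  subst (_⊆ τ₁* ++ τ₂*) (sym (map-++ proj₂ W₁ W₂)) (++⁺ s₁ s₂) ,
  AllPairs.++⁺ agree₁ agree₂ (All.map (λ r → All.map (cross r) R₂) R₁) ,
  All-++⁺ (All.map inj₁ R₁) (All.map inj₂ R₂)

Matched : List ℕ → List ℕ → ℕ → ℕ → Set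
Matched τ τ* x x* = x ∈ τ × x* ∈ τ*

collapse-singleton : CollapseVia (Matched [ x ] [ y ]) [ x ] [ y ]
collapse-singleton (_ ∷ʳ []) _ = [] , refl , minimum _ , [] , []
collapse-singleton (refl ∷ []) _ =
  [ (_ , _) ] , refl , ⊆-refl , [] ∷ [] , (here refl , here refl) ∷ []

collapse-run : ∀ {_∼_ : ℕ → ℕ → Set} →
  (∀ {x y x* y*} → x ∼ y → x* ∼ y* → Agree (x , x*) (y , y*)) →
  AllPairs _∼_ τ → AllPairs _∼_ τ* → 4 ≤ length τ* → CollapseVia (Matched τ τ*) τ τ*
collapse-run {τ* = τ*} agree-∼ mono mono* long {t} s len =
  zip t v , map-proj₁-zip (≤-reflexive (sym length-v)) ,
  subst (_⊆ τ*) (sym (map-proj₂-zip (≤-reflexive length-v))) v⊆τ* ,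
  AllPairs-zip agree-∼ (AllPairs-resp-⊆ s mono) (AllPairs-resp-⊆ v⊆τ* mono*) ,
  All-zip (All.tabulate (lookup s)) (All.tabulate (lookup v⊆τ*))
  where
  v : List ℕ
  v = take (length t) τ*
  v⊆τ* : v ⊆ τ*
  v⊆τ* = take-⊆ (length t) τ*
  length-v : length v ≡ length t
  length-v = trans (length-take (length t) τ*) (m≤n⇒m⊓n≡m (≤-trans len long))

collapse-Matched : CollapseVia R τ τ* → CollapseVia (λ x x* → R x x* × Matched τ τ* x x*) τ τ*
collapse-Matched col s len with col s len
... | W , refl , s* , agreeW , RW =
  W , refl , s* , agreeW ,
  All.zipWith id (RW , All.zipWith id (All-map⁻ (All.tabulate (lookup s)) , All-map⁻ (All.tabulate (lookup s*))))

collapse-min : ∀ {x x* ρ ρ*} → Collapse ρ ρ* → All (x <_) ρ → All (x* <_) ρ* →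
  Collapse (x ∷ ρ) (x* ∷ ρ*)
collapse-min {x} {x*} {ρ} {ρ*} (S , col) below below* =
  _ , collapse-++ collapse-singleton (collapse-Matched col) cross
  where
  cross : Cross (Matched [ x ] [ x* ]) (λ y y* → S y y* × Matched ρ ρ* y y*)
  cross (here refl , here refl) (_ , y∈ , y*∈) = agree-< (All.lookup below y∈) (All.lookup below* y*∈)

_≺_ : List ℕ → List ℕ → Set
xs ≺ ys = ∀ {x y} → x ∈ xs → y ∈ ys → x < y

cross-≺ : ∀ {τ₁ τ₁* τ₂ τ₂*} → τ₁ ≺ τ₂ → τ₁* ≺ τ₂* → Cross (Matched τ₁ τ₁*) (Matched τ₂ τ₂*)
cross-≺ lt lt* (x∈ , x*∈) (y∈ , y*∈) = agree-< (lt x∈ y∈) (lt* x*∈ y*∈)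

cross-≻ : ∀ {τ₁ τ₁* τ₂ τ₂*} → τ₂ ≺ τ₁ → τ₂* ≺ τ₁* → Cross (Matched τ₁ τ₁*) (Matched τ₂ τ₂*)
cross-≻ gt gt* (x∈ , x*∈) (y∈ , y*∈) = agree-> (gt y∈ x∈) (gt* y*∈ x*∈)

-- The three families

down : ℕ → ℕ → List ℕ
down a = applyDownFrom (a +_)

∈-down⁻ : x ∈ down a k → a ≤ x × x < a + k
∈-down⁻ {a = a} m with ∈-applyDownFrom⁻ (a +_) m
... | i , i<k , refl = m≤m+n a i , +-monoʳ-< a i<k

down-positive : ∀ a k → All (0 <_) (down (suc a) k)
down-positive a k = All.tabulate (λ m → <-≤-trans z<s (proj₁ (∈-down⁻ m)))

down-descending : AllPairs _>_ (down a k)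
down-descending {a} {k} = AllPairs.applyDownFrom⁺₁ (a +_) k (λ j<i _ → +-monoʳ-< a j<i)

∈-up⁻ : x ∈ applyUpTo suc j → 0 < x × x < suc j
∈-up⁻ m with ∈-applyUpTo⁻ suc m
... | i , i<j , refl = z<s , s<s i<j

up-ascending : AllPairs _<_ (applyUpTo suc j)
up-ascending {j} = AllPairs.applyUpTo⁺₁ suc j (λ i<j _ → s<s i<j)

≺-down : ∀ {b} → (∀ {x} → x ∈ xs → x < b) → xs ≺ down b k
≺-down below x∈ y∈ = <-≤-trans (below x∈) (proj₁ (∈-down⁻ y∈))

collapse-down : ∀ a k b → CollapseVia (Matched (down a k) (down b 4)) (down a k) (down b 4)
collapse-down a k b = collapse-run agree-> down-descending down-descending ≤-refl

collapse-up : ∀ j →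
  CollapseVia (Matched (applyUpTo suc j) (applyUpTo suc 4)) (applyUpTo suc j) (applyUpTo suc 4)
collapse-up j = collapse-run agree-< up-ascending up-ascending ≤-refl

family₁ : ℕ → ℕ → List ℕ
family₁ j k = 0 ∷ down 1 j ++ down (suc j) k

family₂ : ℕ → ℕ → List ℕ
family₂ i k = 0 ∷ suc i ∷ down (suc (suc i)) k ++ down 1 i

family₃ : ℕ → ℕ → List ℕ
family₃ j k = 0 ∷ applyUpTo suc j ++ down (suc j) (suc k)

Π₁ Π₂ Π₃ : List (List ℕ)
Π₁ = p1234 ∷ p1342 ∷ p1423 ∷ []
Π₂ = p1234 ∷ p1324 ∷ p1423 ∷ []
Π₃ = p1324 ∷ p1342 ∷ p1423 ∷ []

patterns₁ : All Pattern Π₁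
patterns₁ = pattern1234 ∷ pattern1342 ∷ pattern1423 ∷ []

patterns₂ : All Pattern Π₂
patterns₂ = pattern1234 ∷ pattern1324 ∷ pattern1423 ∷ []

patterns₃ : All Pattern Π₃
patterns₃ = pattern1324 ∷ pattern1342 ∷ pattern1423 ∷ []

collapse₁ : Collapse (family₁ j k) (family₁ 4 4)
collapse₁ {j} {k} = collapse-min
  (_ , collapse-++ (collapse-down 1 j 1) (collapse-down (suc j) k 5) low≺high)
  (positive j k) (positive 4 4)
  where
  low≺high : Cross (Matched (down 1 j) (down 1 4)) (Matched (down (suc j) k) (down 5 4))
  low≺high = cross-≺ (≺-down (proj₂ ∘ ∈-down⁻)) (≺-down (proj₂ ∘ ∈-down⁻))
  positive : ∀ j k → All (0 <_) (down 1 j ++ down (suc j) k)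
  positive j k = All-++⁺ (down-positive 0 j) (down-positive j k)

collapse₂ : Collapse (family₂ i k) (family₂ 4 4)
collapse₂ {i} {k} = collapse-min
  (_ , collapse-++ collapse-singleton
         (collapse-++ (collapse-down (suc (suc i)) k 6) (collapse-down 1 i 1) high≻low)
         (cross-⊎ mid≺high mid≻low))
  (positive i k) (positive 4 4)
  where
  high≻low : Cross (Matched (down (suc (suc i)) k) (down 6 4)) (Matched (down 1 i) (down 1 4))
  high≻low = cross-≻ (≺-down (m<n⇒m<1+n ∘ proj₂ ∘ ∈-down⁻))
                     (≺-down (m<n⇒m<1+n ∘ proj₂ ∘ ∈-down⁻))
  mid≺high : Cross (Matched [ suc i ] [ 5 ]) (Matched (down (suc (suc i)) k) (down 6 4))
  mid≺high = cross-≺ (≺-down λ { (here refl) → n<1+n _ }) (≺-down λ { (here refl) → n<1+n _ })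
  mid≻low : Cross (Matched [ suc i ] [ 5 ]) (Matched (down 1 i) (down 1 4))
  mid≻low = cross-≻ (λ { x∈ (here refl) → proj₂ (∈-down⁻ x∈) })
                    (λ { x∈ (here refl) → proj₂ (∈-down⁻ x∈) })
  positive : ∀ i k → All (0 <_) (suc i ∷ down (suc (suc i)) k ++ down 1 i)
  positive i k = z<s ∷ All-++⁺ (down-positive (suc i) k) (down-positive 0 i)

collapse₃ : Collapse (family₃ j k) (family₃ 4 3)
collapse₃ {j} {k} = collapse-min
  (_ , collapse-++ (collapse-up j) (collapse-down (suc j) (suc k) 5) low≺high)
  (positive j k) (positive 4 3)
  where
  low≺high : Cross (Matched (applyUpTo suc j) (applyUpTo suc 4))
                   (Matched (down (suc j) (suc k)) (down 5 4))
  low≺high = cross-≺ (≺-down (proj₂ ∘ ∈-up⁻)) (≺-down (proj₂ ∘ ∈-up⁻))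
  positive : ∀ j k → All (0 <_) (applyUpTo suc j ++ down (suc j) (suc k))
  positive j k = All-++⁺ (All.tabulate (proj₁ ∘ ∈-up⁻)) (down-positive j (suc k))

-- The last argument, avoidance by the representative, holds by evaluation.
avoids₁ : T (cycAvoidsAll Π₁ (family₁ j k))
avoids₁ {j} {k} = cycAvoidsAll-collapse patterns₁ (collapse₁ {j} {k}) _

avoids₂ : T (cycAvoidsAll Π₂ (family₂ i k))
avoids₂ {i} {k} = cycAvoidsAll-collapse patterns₂ (collapse₂ {i} {k}) _

avoids₃ : T (cycAvoidsAll Π₃ (family₃ j k))
avoids₃ {j} {k} = cycAvoidsAll-collapse patterns₃ (collapse₃ {j} {k}) _

-- Inserting a new maximum

∈-insertions⁻ : τ ∈ insertions x σ → ∃₂ λ u v → σ ≡ u ++ v × τ ≡ u ++ x ∷ v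
∈-insertions⁻ {σ = []} (here refl) = [] , [] , refl , refl
∈-insertions⁻ {σ = y ∷ σ} (here refl) = [] , y ∷ σ , refl , refl
∈-insertions⁻ {x = x} {σ = y ∷ σ} (there m) with ∈-map⁻ (y ∷_) m
... | _ , m′ , refl with ∈-insertions⁻ {x = x} m′
...   | u , v , refl , refl = y ∷ u , v , refl , refl

insertionsBefore : ℕ → List ℕ → List (List ℕ)
insertionsBefore x [] = []
insertionsBefore x (y ∷ ys) = (x ∷ y ∷ ys) ∷ map (y ∷_) (insertionsBefore x ys)

∈-insertionsBefore⁻ : τ ∈ insertionsBefore x xs →
  ∃₂ λ u v → ∃ λ y → y ∈ xs × τ ≡ u ++ x ∷ y ∷ v
∈-insertionsBefore⁻ {xs = y ∷ ys} (here refl) = [] , ys , y , here refl , refl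
∈-insertionsBefore⁻ {x = x} {xs = y ∷ ys} (there m) with ∈-map⁻ (y ∷_) m
... | _ , m′ , refl with ∈-insertionsBefore⁻ {x = x} m′
...   | u , v , z , z∈ , refl = y ∷ u , v , z , there z∈ , refl

insertionsAfterHead : ℕ → List ℕ → List (List ℕ)
insertionsAfterHead x [] = []
insertionsAfterHead x (y ∷ ys) = map (y ∷_) (insertions x ys)

∈-insertionsAfterHead⁻ : τ ∈ insertionsAfterHead x (y ∷ ys) → ∃₂ λ u v → τ ≡ y ∷ u ++ x ∷ v
∈-insertionsAfterHead⁻ {x = x} {y = y} m with ∈-map⁻ (y ∷_) m
... | _ , m′ , refl with ∈-insertions⁻ {x = x} m′
...   | u , v , _ , refl = u , v , refl

insertions-head : ∀ x ys → insertions x ys ≡ (x ∷ ys) ∷ insertionsAfterHead x ys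
insertions-head x [] = refl
insertions-head x (y ∷ ys) = refl

insertions-++ : ∀ x xs ys → insertions x (xs ++ ys) ≡
  map (_++ ys) (insertionsBefore x xs) ++ (xs ++ x ∷ ys) ∷ map (xs ++_) (insertionsAfterHead x ys)
insertions-++ x [] [] = refl
insertions-++ x [] (y ∷ ys) = cong ((x ∷ y ∷ ys) ∷_) (sym (map-id (map (y ∷_) (insertions x ys))))
insertions-++ x (y ∷ xs) ys = cong ((x ∷ y ∷ xs ++ ys) ∷_) (begin
  map (y ∷_) (insertions x (xs ++ ys))
    ≡⟨ cong (map (y ∷_)) (insertions-++ x xs ys) ⟩
  map (y ∷_) (map (_++ ys) (insertionsBefore x xs) ++ (xs ++ x ∷ ys) ∷ map (xs ++_) (insertionsAfterHead x ys))
    ≡⟨ map-++ (y ∷_) (map (_++ ys) (insertionsBefore x xs)) _ ⟩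
  map (y ∷_) (map (_++ ys) (insertionsBefore x xs)) ++
  (y ∷ xs ++ x ∷ ys) ∷ map (y ∷_) (map (xs ++_) (insertionsAfterHead x ys))
    ≡⟨ cong₂ (λ bs cs → bs ++ (y ∷ xs ++ x ∷ ys) ∷ cs)
         (trans (sym (map-∘ (insertionsBefore x xs))) (map-∘ (insertionsBefore x xs)))
         (sym (map-∘ (insertionsAfterHead x ys))) ⟩
  map (_++ ys) (map (y ∷_) (insertionsBefore x xs)) ++
  (y ∷ xs ++ x ∷ ys) ∷ map ((y ∷ xs) ++_) (insertionsAfterHead x ys)
    ∎)
  where open ≡-Reasoning

normalAvoider : List (List ℕ) → List ℕ → Bool
normalAvoider Π σ = startsWith0 σ ∧ cycAvoidsAll Π σ

avoiders : List (List ℕ) → ℕ → List (List ℕ)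
avoiders Π n = filterᵇ (normalAvoider Π) (perms n)

normalAvoider-delete : All (λ π → 0 < length π) Π → τ ∈ insertions (suc x) σ →
  T (normalAvoider Π τ) → T (normalAvoider Π σ)
normalAvoider-delete {x = x} nonempty m ok with ∈-insertions⁻ {x = suc x} m
... | [] , _ , refl , refl = ⊥-elim ok
... | suc _ ∷ _ , _ , refl , refl = ⊥-elim ok
... | zero ∷ u , v , refl , refl = cycAvoidsAll-⊆ nonempty (refl ∷ ++⁺ (⊆-refl {x = u}) (suc x ∷ʳ ⊆-refl)) ok

avoiders-suc : All (λ π → 0 < length π) Π → ∀ n →
  avoiders Π (suc (suc n)) ≡
  concatMap (filterᵇ (normalAvoider Π) ∘ insertions (suc n)) (avoiders Π (suc n))
avoiders-suc {Π} nonempty n =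
  trans (filterᵇ-concatMap (normalAvoider Π) (insertions (suc n)) (perms (suc n)))
        (concatMap-filterᵇ (normalAvoider Π) _ vanish (perms (suc n)))
  where
  vanish : ∀ σ → ¬ T (normalAvoider Π σ) → filterᵇ (normalAvoider Π) (insertions (suc n) σ) ≡ []
  vanish σ ¬ok =
    filterᵇ-none {xs = insertions (suc n) σ} (λ m ok → ¬ok (normalAvoider-delete {σ = σ} nonempty m ok))

avoids₀ : List (List ℕ) → List ℕ → Bool
avoids₀ Π ρ = cycAvoidsAll Π (0 ∷ ρ)

-- The insertion in front of 0 is rejected by evaluation.
normalAvoider-insertions : ∀ Π x ρ →
  filterᵇ (normalAvoider Π) (insertions (suc x) (0 ∷ ρ)) ≡
  map (0 ∷_) (filterᵇ (avoids₀ Π) (insertions (suc x) ρ))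
normalAvoider-insertions Π x ρ = filterᵇ-map (normalAvoider Π) (0 ∷_) (insertions (suc x) ρ)

subsequence⇒¬avoids₀ : π ∈ Π → t ⊆ σ → T (orderIso π (0 ∷ t)) → ¬ T (avoids₀ Π σ)
subsequence⇒¬avoids₀ {π} {t = t} {σ} π∈Π s iso = cycContains⇒¬cycAvoidsAll {σ = 0 ∷ σ} π∈Π
  (cycContains-subsequence {π} {0 ∷ t} {0 ∷ σ} (subst (0 <_) (sym (length-orderIso π _ iso)) z<s) (refl ∷ s) iso)

-- Each family reproduces itself

grow : ℕ × ℕ → List (ℕ × ℕ)
grow (i , zero) = (suc i , 0) ∷ (i , 1) ∷ []
grow (i , suc k) = [ (i , suc (suc k)) ]

family₁-inside : ∀ {E τ} → suc i < x → τ ∈ map (_++ E) (insertionsBefore x (down 1 i)) →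
  ¬ T (avoids₀ Π₁ (suc i ∷ τ))
family₁-inside {i} {x} {E} i<x m with ∈-map⁻ (_++ E) m
... | _ , m′ , refl with ∈-insertionsBefore⁻ {x = x} m′
...   | u , v , a , a∈ , refl =
  subsequence⇒¬avoids₀ {Π = Π₁} (there (here refl)) (refl ∷ ++⁺ʳ E (++⁺ˡ u (refl ∷ refl ∷ minimum v)))
    (orderIso-1342 (proj₁ (∈-down⁻ a∈)) (proj₂ (∈-down⁻ a∈)) i<x)

family₁-grow : ∀ i k → filterᵇ (normalAvoider Π₁) (insertions (suc (suc i + k)) (family₁ (suc i) k)) ≡
  map (uncurry (family₁ ∘ suc)) (grow (i , k))
family₁-grow i zero = begin
  filterᵇ (normalAvoider Π₁) (insertions s (0 ∷ suc i ∷ D ++ []))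
    ≡⟨ normalAvoider-insertions Π₁ (suc i + 0) (suc i ∷ D ++ []) ⟩
  map (0 ∷_) (filterᵇ keep ((s ∷ suc i ∷ D ++ []) ∷ map (suc i ∷_) (insertions s (D ++ []))))
    ≡⟨ cong (map (0 ∷_)) (filter-accept (T? ∘ keep) top) ⟩
  map (0 ∷_) ((s ∷ suc i ∷ D ++ []) ∷ filterᵇ keep (map (suc i ∷_) (insertions s (D ++ []))))
    ≡⟨ cong (λ τs → map (0 ∷_) ((s ∷ suc i ∷ D ++ []) ∷ τs))
         (filterᵇ-map keep (suc i ∷_) (insertions s (D ++ []))) ⟩
  map (0 ∷_) ((s ∷ suc i ∷ D ++ []) ∷ map (suc i ∷_) (filterᵇ keep′ (insertions s (D ++ []))))
    ≡⟨ cong (λ τs → map (0 ∷_) ((s ∷ suc i ∷ D ++ []) ∷ map (suc i ∷_) τs)) after-top ⟩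
  (0 ∷ s ∷ suc i ∷ D ++ []) ∷ family₁ (suc i) 1 ∷ []
    ≡⟨ cong (λ m → (0 ∷ suc m ∷ suc i ∷ D ++ []) ∷ family₁ (suc i) 1 ∷ []) (+-identityʳ (suc i)) ⟩
  family₁ (suc (suc i)) 0 ∷ family₁ (suc i) 1 ∷ []
    ∎
  where
  open ≡-Reasoning
  s : ℕ
  s = suc (suc i + 0)
  D : List ℕ
  D = down 1 i
  keep keep′ : List ℕ → Bool
  keep = avoids₀ Π₁
  keep′ = keep ∘ (suc i ∷_)
  top : T (keep (s ∷ suc i ∷ D ++ []))
  top = subst (λ m → T (keep (suc m ∷ suc i ∷ D ++ []))) (sym (+-identityʳ (suc i))) (avoids₁ {suc (suc i)} {0})
  after-top : filterᵇ keep′ (insertions s (D ++ [])) ≡ [ D ++ [ s ] ]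
  after-top = begin
    filterᵇ keep′ (insertions s (D ++ []))
      ≡⟨ cong (filterᵇ keep′) (insertions-++ s D []) ⟩
    filterᵇ keep′ (map (_++ []) (insertionsBefore s D) ++ [ D ++ [ s ] ])
      ≡⟨ filter-++ (T? ∘ keep′) (map (_++ []) (insertionsBefore s D)) _ ⟩
    filterᵇ keep′ (map (_++ []) (insertionsBefore s D)) ++ filterᵇ keep′ [ D ++ [ s ] ]
      ≡⟨ cong₂ _++_ (filterᵇ-none (family₁-inside {i} (s≤s (s≤s (m≤m+n i 0)))))
                    (filter-accept (T? ∘ keep′) (avoids₁ {suc i} {1})) ⟩
    [ D ++ [ s ] ]
      ∎
family₁-grow i (suc k) = begin
  filterᵇ (normalAvoider Π₁) (insertions s (0 ∷ suc i ∷ D ++ E))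
    ≡⟨ normalAvoider-insertions Π₁ (suc i + suc k) (suc i ∷ D ++ E) ⟩
  map (0 ∷_) (filterᵇ keep ((s ∷ suc i ∷ D ++ E) ∷ map (suc i ∷_) (insertions s (D ++ E))))
    ≡⟨ cong (map (0 ∷_))
         (filter-reject (T? ∘ keep) {s ∷ suc i ∷ D ++ E} {map (suc i ∷_) (insertions s (D ++ E))} top) ⟩
  map (0 ∷_) (filterᵇ keep (map (suc i ∷_) (insertions s (D ++ E))))
    ≡⟨ cong (map (0 ∷_)) (filterᵇ-map keep (suc i ∷_) (insertions s (D ++ E))) ⟩
  map (0 ∷_) (map (suc i ∷_) (filterᵇ keep′ (insertions s (D ++ E))))
    ≡⟨ cong (map (0 ∷_) ∘ map (suc i ∷_)) after-top ⟩
  [ family₁ (suc i) (suc (suc k)) ]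
    ∎
  where
  open ≡-Reasoning
  s d : ℕ
  s = suc (suc i + suc k)
  d = suc (suc i) + k
  D E′ E : List ℕ
  D = down 1 i
  E′ = down (suc (suc i)) k
  E = d ∷ E′
  keep keep′ : List ℕ → Bool
  keep = avoids₀ Π₁
  keep′ = keep ∘ (suc i ∷_)
  i<d : suc i < d
  i<d = s≤s (s≤s (m≤m+n i k))
  d<s : d < s
  d<s = s<s (s<s (+-monoʳ-< i (n<1+n k)))
  top : ¬ T (keep (s ∷ suc i ∷ D ++ E))
  top = subsequence⇒¬avoids₀ {Π = Π₁} (there (there (here refl))) (refl ∷ refl ∷ ++⁺ˡ D (refl ∷ minimum E′))
    (orderIso-1423 z<s i<d d<s)
  inside-E : ∀ {τ} → τ ∈ map (D ++_) (insertionsAfterHead s E) → ¬ T (keep′ τ)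
  inside-E m with ∈-map⁻ (D ++_) m
  ... | _ , m′ , refl with ∈-insertionsAfterHead⁻ {x = s} {y = d} {ys = E′} m′
  ...   | u , v , refl = subsequence⇒¬avoids₀ {Π = Π₁} (here refl)
    (refl ∷ ++⁺ˡ D (refl ∷ ++⁺ˡ u (refl ∷ minimum v))) (orderIso-1234 z<s i<d d<s)
  after-top : filterᵇ keep′ (insertions s (D ++ E)) ≡ [ D ++ s ∷ E ]
  after-top = begin
    filterᵇ keep′ (insertions s (D ++ E))
      ≡⟨ cong (filterᵇ keep′) (insertions-++ s D E) ⟩
    filterᵇ keep′ (map (_++ E) (insertionsBefore s D) ++ (D ++ s ∷ E) ∷ map (D ++_) (insertionsAfterHead s E))
      ≡⟨ filter-++ (T? ∘ keep′) (map (_++ E) (insertionsBefore s D)) _ ⟩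
    filterᵇ keep′ (map (_++ E) (insertionsBefore s D)) ++
    filterᵇ keep′ ((D ++ s ∷ E) ∷ map (D ++_) (insertionsAfterHead s E))
      ≡⟨ cong₂ _++_ (filterᵇ-none (family₁-inside {i} (<-trans i<d d<s)))
                    (filter-accept (T? ∘ keep′) (avoids₁ {suc i} {suc (suc k)})) ⟩
    (D ++ s ∷ E) ∷ filterᵇ keep′ (map (D ++_) (insertionsAfterHead s E))
      ≡⟨ cong ((D ++ s ∷ E) ∷_) (filterᵇ-none inside-E) ⟩
    [ D ++ s ∷ E ]
      ∎

family₂-inside : suc i < x → τ ∈ insertionsAfterHead x (down 1 i) → ¬ T (avoids₀ Π₂ (suc i ∷ τ))
family₂-inside {suc i} {x} i<x m with ∈-insertionsAfterHead⁻ {x = x} {y = suc i} {ys = down 1 i} m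
... | u , v , refl = subsequence⇒¬avoids₀ {Π = Π₂} (there (here refl))
  (refl ∷ refl ∷ ++⁺ˡ u (refl ∷ minimum v)) (orderIso-1324 z<s (n<1+n (suc i)) i<x)

family₂-grow : ∀ i k → filterᵇ (normalAvoider Π₂) (insertions (suc (suc i + k)) (family₂ i k)) ≡
  map (uncurry family₂) (grow (i , k))
family₂-grow i zero = begin
  filterᵇ (normalAvoider Π₂) (insertions s (0 ∷ suc i ∷ D))
    ≡⟨ normalAvoider-insertions Π₂ (suc i + 0) (suc i ∷ D) ⟩
  map (0 ∷_) (filterᵇ keep ((s ∷ suc i ∷ D) ∷ map (suc i ∷_) (insertions s D)))
    ≡⟨ cong (map (0 ∷_)) (filter-accept (T? ∘ keep) top) ⟩
  map (0 ∷_) ((s ∷ suc i ∷ D) ∷ filterᵇ keep (map (suc i ∷_) (insertions s D)))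
    ≡⟨ cong (λ τs → map (0 ∷_) ((s ∷ suc i ∷ D) ∷ τs)) (filterᵇ-map keep (suc i ∷_) (insertions s D)) ⟩
  map (0 ∷_) ((s ∷ suc i ∷ D) ∷ map (suc i ∷_) (filterᵇ keep′ (insertions s D)))
    ≡⟨ cong (λ τs → map (0 ∷_) ((s ∷ suc i ∷ D) ∷ map (suc i ∷_) τs)) after-top ⟩
  (0 ∷ s ∷ suc i ∷ D) ∷ family₂ i 1 ∷ []
    ≡⟨ cong (λ m → (0 ∷ suc m ∷ suc i ∷ D) ∷ family₂ i 1 ∷ []) (+-identityʳ (suc i)) ⟩
  family₂ (suc i) 0 ∷ family₂ i 1 ∷ []
    ∎
  where
  open ≡-Reasoning
  s : ℕ
  s = suc (suc i + 0)
  D : List ℕ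
  D = down 1 i
  keep keep′ : List ℕ → Bool
  keep = avoids₀ Π₂
  keep′ = keep ∘ (suc i ∷_)
  top : T (keep (s ∷ suc i ∷ D))
  top = subst (λ m → T (keep (suc m ∷ suc i ∷ D))) (sym (+-identityʳ (suc i))) (avoids₂ {suc i} {0})
  after-top : filterᵇ keep′ (insertions s D) ≡ [ s ∷ D ]
  after-top = begin
    filterᵇ keep′ (insertions s D)
      ≡⟨ cong (filterᵇ keep′) (insertions-head s D) ⟩
    filterᵇ keep′ ((s ∷ D) ∷ insertionsAfterHead s D)
      ≡⟨ filter-accept (T? ∘ keep′) (avoids₂ {i} {1}) ⟩
    (s ∷ D) ∷ filterᵇ keep′ (insertionsAfterHead s D)
      ≡⟨ cong ((s ∷ D) ∷_) (filterᵇ-none (family₂-inside {i} (s≤s (s≤s (m≤m+n i 0))))) ⟩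
    [ s ∷ D ]
      ∎
family₂-grow i (suc k) = begin
  filterᵇ (normalAvoider Π₂) (insertions s (0 ∷ suc i ∷ H ++ D))
    ≡⟨ normalAvoider-insertions Π₂ (suc i + suc k) (suc i ∷ H ++ D) ⟩
  map (0 ∷_) (filterᵇ keep ((s ∷ suc i ∷ H ++ D) ∷ map (suc i ∷_) (insertions s (H ++ D))))
    ≡⟨ cong (map (0 ∷_))
         (filter-reject (T? ∘ keep) {s ∷ suc i ∷ H ++ D} {map (suc i ∷_) (insertions s (H ++ D))} top) ⟩
  map (0 ∷_) (filterᵇ keep (map (suc i ∷_) (insertions s (H ++ D))))
    ≡⟨ cong (map (0 ∷_)) (filterᵇ-map keep (suc i ∷_) (insertions s (H ++ D))) ⟩
  map (0 ∷_) (map (suc i ∷_) (filterᵇ keep′ ((s ∷ H ++ D) ∷ map (h ∷_) (insertions s (H′ ++ D)))))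
    ≡⟨ cong (map (0 ∷_) ∘ map (suc i ∷_)) (filter-accept (T? ∘ keep′) (avoids₂ {i} {suc (suc k)})) ⟩
  map (0 ∷_) (map (suc i ∷_) ((s ∷ H ++ D) ∷ filterᵇ keep′ (map (h ∷_) (insertions s (H′ ++ D)))))
    ≡⟨ cong (λ τs → map (0 ∷_) (map (suc i ∷_) ((s ∷ H ++ D) ∷ τs))) (filterᵇ-none inside-H) ⟩
  [ family₂ i (suc (suc k)) ]
    ∎
  where
  open ≡-Reasoning
  s h : ℕ
  s = suc (suc i + suc k)
  h = suc (suc i) + k
  D H′ H : List ℕ
  D = down 1 i
  H′ = down (suc (suc i)) k
  H = h ∷ H′
  keep keep′ : List ℕ → Bool
  keep = avoids₀ Π₂
  keep′ = keep ∘ (suc i ∷_)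
  i<h : suc i < h
  i<h = s≤s (s≤s (m≤m+n i k))
  h<s : h < s
  h<s = s<s (s<s (+-monoʳ-< i (n<1+n k)))
  top : ¬ T (keep (s ∷ suc i ∷ H ++ D))
  top = subsequence⇒¬avoids₀ {Π = Π₂} (there (there (here refl)))
    (refl ∷ refl ∷ refl ∷ minimum (H′ ++ D)) (orderIso-1423 z<s i<h h<s)
  inside-H : ∀ {τ} → τ ∈ map (h ∷_) (insertions s (H′ ++ D)) → ¬ T (keep′ τ)
  inside-H m with ∈-insertionsAfterHead⁻ {x = s} {y = h} {ys = H′ ++ D} m
  ... | u , v , refl = subsequence⇒¬avoids₀ {Π = Π₂} (here refl)
    (refl ∷ refl ∷ ++⁺ˡ u (refl ∷ minimum v)) (orderIso-1234 z<s i<h h<s)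

newRun : ℕ × ℕ → List (ℕ × ℕ)
newRun (j , zero) = [ (suc j , 0) ]
newRun (j , suc k) = []

grow′ : ℕ × ℕ → List (ℕ × ℕ)
grow′ (j , k) = (j , suc k) ∷ newRun (j , k)

family₃-grow-after-top : ∀ j k →
  map (0 ∷_) (filterᵇ (avoids₀ Π₃)
    (map (applyUpTo suc j ++_) (insertionsAfterHead (suc (suc j + k)) (down (suc j) (suc k))))) ≡
  map (uncurry family₃) (newRun (j , k))
family₃-grow-after-top j zero =
  trans (cong (map (0 ∷_)) (filter-accept (T? ∘ avoids₀ Π₃) (subst (T ∘ avoids₀ Π₃) snoc (avoids₃ {suc j} {0}))))
        (cong (λ τ → [ 0 ∷ τ ]) (sym snoc))
  where
  open ≡-Reasoning
  U : List ℕ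
  U = applyUpTo suc j
  s : ℕ
  s = suc (suc j + 0)
  snoc : applyUpTo suc (suc j) ++ [ s ] ≡ U ++ suc j + 0 ∷ [ s ]
  snoc = begin
    applyUpTo suc (suc j) ++ [ s ]     ≡⟨ cong (_++ [ s ]) (sym (applyUpTo-∷ʳ suc j)) ⟩
    (U ++ [ suc j ]) ++ [ s ]          ≡⟨ ++-assoc U [ suc j ] [ s ] ⟩
    U ++ suc j ∷ [ s ]                 ≡⟨ cong (λ x → U ++ suc x ∷ [ s ]) (sym (+-identityʳ j)) ⟩
    U ++ suc j + 0 ∷ [ s ]             ∎
family₃-grow-after-top j (suc k) = cong (map (0 ∷_)) (filterᵇ-none bad)
  where
  U : List ℕ
  U = applyUpTo suc j
  s m d : ℕ
  s = suc (suc j + suc k)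
  m = suc j + suc k
  d = suc j + k
  m<s : m < s
  m<s = n<1+n m
  d<m : d < m
  d<m = +-monoʳ-< (suc j) (n<1+n k)
  bad : ∀ {τ} → τ ∈ map (U ++_) (map (m ∷_) (insertions s (d ∷ down (suc j) k))) → ¬ T (avoids₀ Π₃ τ)
  bad τ∈ with ∈-map⁻ (U ++_) τ∈
  ... | _ , τ∈′ , refl with ∈-map⁻ (m ∷_) τ∈′
  ...   | _ , here refl , refl = subsequence⇒¬avoids₀ {Π = Π₃} (there (here refl))
    (++⁺ˡ U (refl ∷ refl ∷ refl ∷ minimum _)) (orderIso-1342 z<s d<m m<s)
  ...   | _ , there τ∈″ , refl with ∈-map⁻ (d ∷_) τ∈″
  ...     | _ , τ∈‴ , refl with ∈-insertions⁻ {x = s} τ∈‴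
  ...       | u , v , _ , refl = subsequence⇒¬avoids₀ {Π = Π₃} (here refl)
    (++⁺ˡ U (refl ∷ refl ∷ ++⁺ˡ u (refl ∷ minimum v))) (orderIso-1324 z<s d<m m<s)

family₃-grow : ∀ j k → filterᵇ (normalAvoider Π₃) (insertions (suc (suc j + k)) (family₃ j k)) ≡
  map (uncurry family₃) (grow′ (j , k))
family₃-grow j k = begin
  filterᵇ (normalAvoider Π₃) (insertions s (0 ∷ U ++ M))
    ≡⟨ normalAvoider-insertions Π₃ (suc j + k) (U ++ M) ⟩
  map (0 ∷_) (filterᵇ keep (insertions s (U ++ M)))
    ≡⟨ cong (map (0 ∷_) ∘ filterᵇ keep) (insertions-++ s U M) ⟩
  map (0 ∷_) (filterᵇ keep (map (_++ M) (insertionsBefore s U) ++ (U ++ s ∷ M) ∷ after-m))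
    ≡⟨ cong (map (0 ∷_)) (filter-++ (T? ∘ keep) (map (_++ M) (insertionsBefore s U)) _) ⟩
  map (0 ∷_) (filterᵇ keep (map (_++ M) (insertionsBefore s U)) ++ filterᵇ keep ((U ++ s ∷ M) ∷ after-m))
    ≡⟨ cong (map (0 ∷_)) (cong₂ _++_ (filterᵇ-none inside-U) (filter-accept (T? ∘ keep) good)) ⟩
  map (0 ∷_) ((U ++ s ∷ M) ∷ filterᵇ keep after-m)
    ≡⟨ cong (λ x → (0 ∷ U ++ x ∷ M) ∷ map (0 ∷_) (filterᵇ keep after-m)) (sym (+-suc (suc j) k)) ⟩
  family₃ j (suc k) ∷ map (0 ∷_) (filterᵇ keep after-m)
    ≡⟨ cong (family₃ j (suc k) ∷_) (family₃-grow-after-top j k) ⟩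
  map (uncurry family₃) (grow′ (j , k))
    ∎
  where
  open ≡-Reasoning
  s m : ℕ
  s = suc (suc j + k)
  m = suc j + k
  U D M : List ℕ
  U = applyUpTo suc j
  D = down (suc j) k
  M = m ∷ D
  keep : List ℕ → Bool
  keep = avoids₀ Π₃
  after-m : List (List ℕ)
  after-m = map (U ++_) (insertionsAfterHead s M)
  good : T (keep (U ++ s ∷ M))
  good = subst (λ x → T (keep (U ++ x ∷ M))) (+-suc (suc j) k) (avoids₃ {j} {suc k})
  inside-U : ∀ {τ} → τ ∈ map (_++ M) (insertionsBefore s U) → ¬ T (keep τ)
  inside-U τ∈ with ∈-map⁻ (_++ M) τ∈
  ... | _ , τ∈′ , refl with ∈-insertionsBefore⁻ {x = s} τ∈′
  ...   | u , v , a , a∈ , refl = subsequence⇒¬avoids₀ {Π = Π₃} (there (there (here refl)))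
    (++⁺ (++⁺ˡ u (refl ∷ refl ∷ minimum v)) (refl ∷ minimum D))
    (orderIso-1423 (proj₁ (∈-up⁻ a∈)) (<-≤-trans (proj₂ (∈-up⁻ a∈)) (s≤s (m≤m+n j k))) (n<1+n m))

-- The avoiders are exactly the families

avoiders-by-growth : All (λ π → 0 < length π) Π →
  (F : ℕ × ℕ → List ℕ) (g : ℕ × ℕ → List (ℕ × ℕ)) (codes : ℕ → List (ℕ × ℕ)) →
  (∀ t {c} → c ∈ codes t → proj₁ c + proj₂ c ≡ t) →
  (∀ i k → filterᵇ (normalAvoider Π) (insertions (suc (suc i + k)) (F (i , k))) ≡ map F (g (i , k))) →
  (∀ t → concatMap g (codes t) ≡ codes (suc t)) →
  avoiders Π 2 ≡ map F (codes 0) →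
  ∀ t → avoiders Π (suc (suc t)) ≡ map F (codes t)
avoiders-by-growth nonempty F g codes sum grow-step grows base zero = base
avoiders-by-growth {Π} nonempty F g codes sum grow-step grows base (suc t) = begin
  avoiders Π (suc (suc (suc t)))
    ≡⟨ avoiders-suc nonempty (suc t) ⟩
  concatMap insert (avoiders Π (suc (suc t)))
    ≡⟨ cong (concatMap insert) (avoiders-by-growth nonempty F g codes sum grow-step grows base t) ⟩
  concatMap insert (map F (codes t))
    ≡⟨ concatMap-map insert F (codes t) ⟩
  concatMap (insert ∘ F) (codes t)
    ≡⟨ cong concat (map-cong-local (All.tabulate step)) ⟩
  concatMap (map F ∘ g) (codes t)
    ≡⟨ sym (map-concatMap F g (codes t)) ⟩
  map F (concatMap g (codes t))
    ≡⟨ cong (map F) (grows t) ⟩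
  map F (codes (suc t))
    ∎
  where
  open ≡-Reasoning
  insert : List ℕ → List (List ℕ)
  insert = filterᵇ (normalAvoider Π) ∘ insertions (suc (suc t))
  step : ∀ {c} → c ∈ codes t → insert (F c) ≡ map F (g c)
  step {i , k} c∈ =
    subst (λ n → filterᵇ (normalAvoider Π) (insertions (suc (suc n)) (F (i , k))) ≡ map F (g (i , k)))
          (sum t c∈) (grow-step i k)

diagonal : ℕ → List (ℕ × ℕ)
diagonal zero = [ (0 , 0) ]
diagonal (suc t) = (suc t , 0) ∷ map (map₂ suc) (diagonal t)

antidiagonal : ℕ → List (ℕ × ℕ)
antidiagonal zero = [ (0 , 0) ]
antidiagonal (suc t) = map (map₂ suc) (antidiagonal t) ++ [ (suc t , 0) ]

∈-map₂-suc⁻ : ∀ {c cs t} → c ∈ map (map₂ suc) cs → (∀ {c} → c ∈ cs → proj₁ c + proj₂ c ≡ t) →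
  proj₁ c + proj₂ c ≡ suc t
∈-map₂-suc⁻ m sum with ∈-map⁻ (map₂ suc) m
... | (i , k) , m′ , refl = trans (+-suc i k) (cong suc (sum m′))

∈-diagonal⁻ : ∀ t {c} → c ∈ diagonal t → proj₁ c + proj₂ c ≡ t
∈-diagonal⁻ zero (here refl) = refl
∈-diagonal⁻ (suc t) (here refl) = +-identityʳ (suc t)
∈-diagonal⁻ (suc t) (there m) = ∈-map₂-suc⁻ m (∈-diagonal⁻ t)

∈-antidiagonal⁻ : ∀ t {c} → c ∈ antidiagonal t → proj₁ c + proj₂ c ≡ t
∈-antidiagonal⁻ zero (here refl) = refl
∈-antidiagonal⁻ (suc t) m with ∈-++⁻ (map (map₂ suc) (antidiagonal t)) m
... | inj₁ m′ = ∈-map₂-suc⁻ m′ (∈-antidiagonal⁻ t)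
... | inj₂ (here refl) = +-identityʳ (suc t)

length-diagonal : ∀ t → length (diagonal t) ≡ suc t
length-diagonal zero = refl
length-diagonal (suc t) = cong suc (trans (length-map (map₂ suc) (diagonal t)) (length-diagonal t))

concatMap-map₂-suc : ∀ (g : ℕ × ℕ → List (ℕ × ℕ)) → (∀ i k → g (i , suc k) ≡ [ (i , suc (suc k)) ]) →
  ∀ cs → concatMap g (map (map₂ suc) cs) ≡ map (map₂ suc) (map (map₂ suc) cs)
concatMap-map₂-suc g g-suc [] = refl
concatMap-map₂-suc g g-suc ((i , k) ∷ cs) = cong₂ _++_ (g-suc i k) (concatMap-map₂-suc g g-suc cs)

concatMap-grow : ∀ t → concatMap grow (diagonal t) ≡ diagonal (suc t)
concatMap-grow zero = refl
concatMap-grow (suc t) =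
  cong (λ cs → (suc (suc t) , 0) ∷ (suc t , 1) ∷ cs) (concatMap-map₂-suc grow (λ _ _ → refl) (diagonal t))

concatMap-grow′ : ∀ t → concatMap grow′ (antidiagonal t) ≡ antidiagonal (suc t)
concatMap-grow′ zero = refl
concatMap-grow′ (suc t) = begin
  concatMap grow′ (bumped ++ [ (suc t , 0) ])
    ≡⟨ concatMap-++ grow′ bumped [ (suc t , 0) ] ⟩
  concatMap grow′ bumped ++ (suc t , 1) ∷ [ (suc (suc t) , 0) ]
    ≡⟨ cong (_++ (suc t , 1) ∷ [ (suc (suc t) , 0) ]) (concatMap-map₂-suc grow′ (λ _ _ → refl) (antidiagonal t)) ⟩
  map (map₂ suc) bumped ++ (suc t , 1) ∷ [ (suc (suc t) , 0) ]
    ≡⟨ sym (++-assoc (map (map₂ suc) bumped) [ (suc t , 1) ] [ (suc (suc t) , 0) ]) ⟩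
  (map (map₂ suc) bumped ++ [ (suc t , 1) ]) ++ [ (suc (suc t) , 0) ]
    ≡⟨ cong (_++ [ (suc (suc t) , 0) ]) (sym (map-++ (map₂ suc) bumped [ (suc t , 0) ])) ⟩
  map (map₂ suc) (bumped ++ [ (suc t , 0) ]) ++ [ (suc (suc t) , 0) ]
    ∎
  where
  open ≡-Reasoning
  bumped : List (ℕ × ℕ)
  bumped = map (map₂ suc) (antidiagonal t)

avoiders₁ : ∀ t → avoiders Π₁ (suc (suc t)) ≡ map (uncurry (family₁ ∘ suc)) (diagonal t)
avoiders₁ = avoiders-by-growth (nonempty-patterns patterns₁) (uncurry (family₁ ∘ suc)) grow diagonal
  ∈-diagonal⁻ family₁-grow concatMap-grow refl

avoiders₂ : ∀ t → avoiders Π₂ (suc (suc t)) ≡ map (uncurry family₂) (diagonal t)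
avoiders₂ = avoiders-by-growth (nonempty-patterns patterns₂) (uncurry family₂) grow diagonal
  ∈-diagonal⁻ family₂-grow concatMap-grow refl

avoiders₃ : ∀ t → avoiders Π₃ (suc (suc t)) ≡ map (uncurry family₃) (antidiagonal t)
avoiders₃ = avoiders-by-growth (nonempty-patterns patterns₃) (uncurry family₃) grow′ antidiagonal
  ∈-antidiagonal⁻ family₃-grow concatMap-grow′ refl

-- Cyclic descents and the main theorem

descents : ℕ → ℕ → List ℕ → ℕ
descents w p [] = if w <ᵇ p then 1 else 0
descents w p (y ∷ ys) = (if y <ᵇ p then 1 else 0) + descents w y ys

cdes-descents : ∀ x xs → cdes (x ∷ xs) ≡ descents x x xs
cdes-descents x = go x
  where
  go : ∀ p ys → length (filterᵇ id (zipWith (λ a b → b <ᵇ a) (p ∷ ys) (ys ++ [ x ]))) ≡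
    descents x p ys
  go p [] with x <ᵇ p
  ... | true = refl
  ... | false = refl
  go p (y ∷ ys) with y <ᵇ p
  ... | true = cong suc (go y ys)
  ... | false = go y ys

descents-ascent : ∀ {w p y} ys → p < y → descents w p (y ∷ ys) ≡ descents w y ys
descents-ascent {w} {y = y} ys p<y =
  cong (λ b → (if b then 1 else 0) + descents w y ys) (<ᵇ-false (<⇒≤ p<y))

descents-descent : ∀ {w p y} ys → y < p → descents w p (y ∷ ys) ≡ suc (descents w y ys)
descents-descent {w} {y = y} ys y<p =
  cong (λ b → (if b then 1 else 0) + descents w y ys) (<ᵇ-true y<p)

descents-down : ∀ {w} a k ys → descents w (a + k) (down a k ++ ys) ≡ k + descents w a ys
descents-down {w} a zero ys = cong (λ p → descents w p ys) (+-identityʳ a)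
descents-down a (suc k) ys =
  trans (descents-descent (down a k ++ ys) (+-monoʳ-< a (n<1+n k))) (cong suc (descents-down a k ys))

descents-down-end : ∀ a k → descents 0 (suc a + k) (down (suc a) k) ≡ suc k
descents-down-end a k = begin
  descents 0 (suc a + k) (down (suc a) k)
    ≡⟨ cong (descents 0 (suc a + k)) (sym (++-identityʳ (down (suc a) k))) ⟩
  descents 0 (suc a + k) (down (suc a) k ++ [])
    ≡⟨ descents-down (suc a) k [] ⟩
  k + 1
    ≡⟨ +-comm k 1 ⟩
  suc k
    ∎
  where open ≡-Reasoning

descents-up : ∀ {w p} (f : ℕ → ℕ) j ys → (∀ i → f i < f (suc i)) → p < f 0 →
  descents w p (applyUpTo f (suc j) ++ ys) ≡ descents w (f j) ys
descents-up f zero ys _ p<f₀ = descents-ascent ys p<f₀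
descents-up f (suc j) ys f-increasing p<f₀ =
  trans (descents-ascent (applyUpTo (f ∘ suc) (suc j) ++ ys) p<f₀)
        (descents-up (f ∘ suc) j ys (f-increasing ∘ suc) (f-increasing 0))

descents-up-from-0 : ∀ {w} j ys → descents w 0 (applyUpTo suc j ++ ys) ≡ descents w j ys
descents-up-from-0 zero ys = refl
descents-up-from-0 (suc j) ys = descents-up suc j ys (λ i → n<1+n (suc i)) z<s

cdes-family₁-0 : ∀ i → cdes (family₁ (suc i) 0) ≡ suc i
cdes-family₁-0 i =
  trans (cdes-descents 0 (down 1 (suc i) ++ [])) (trans (descents-down 1 i []) (+-comm i 1))

cdes-family₁-suc : ∀ i k → cdes (family₁ (suc i) (suc k)) ≡ suc (i + k)
cdes-family₁-suc i k = begin
  cdes (family₁ (suc i) (suc k))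
    ≡⟨ cdes-descents 0 (down 1 (suc i) ++ down (suc (suc i)) (suc k)) ⟩
  descents 0 (1 + i) (down 1 i ++ down (suc (suc i)) (suc k))
    ≡⟨ descents-down 1 i _ ⟩
  i + descents 0 (suc (suc i) + k) (down (suc (suc i)) k)
    ≡⟨ cong (i +_) (descents-down-end (suc i) k) ⟩
  i + suc k
    ≡⟨ +-suc i k ⟩
  suc (i + k)
    ∎
  where open ≡-Reasoning

cdes-family₂-0 : ∀ i → cdes (family₂ i 0) ≡ suc i
cdes-family₂-0 i = trans (cdes-descents 0 (suc i ∷ down 1 i)) (descents-down-end 0 i)

cdes-family₂-suc : ∀ i k → cdes (family₂ i (suc k)) ≡ suc (i + k)
cdes-family₂-suc i k = begin
  cdes (family₂ i (suc k))
    ≡⟨ cdes-descents 0 (suc i ∷ down (suc (suc i)) (suc k) ++ down 1 i) ⟩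
  descents 0 (suc i) (suc (suc i) + k ∷ down (suc (suc i)) k ++ down 1 i)
    ≡⟨ descents-ascent (down (suc (suc i)) k ++ down 1 i) (s≤s (s≤s (m≤m+n i k))) ⟩
  descents 0 (suc (suc i) + k) (down (suc (suc i)) k ++ down 1 i)
    ≡⟨ descents-down (suc (suc i)) k (down 1 i) ⟩
  k + descents 0 (suc (suc i)) (down 1 i)
    ≡⟨ cong (k +_) (below i) ⟩
  k + suc i
    ≡⟨ trans (+-suc k i) (cong suc (+-comm k i)) ⟩
  suc (i + k)
    ∎
  where
  open ≡-Reasoning
  below : ∀ i → descents 0 (suc (suc i)) (down 1 i) ≡ suc i
  below zero = refl
  below (suc i) =
    trans (descents-descent (down 1 i) (m<n⇒m<1+n (n<1+n (suc i)))) (cong suc (descents-down-end 0 i))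

cdes-family₃ : ∀ j k → cdes (family₃ j k) ≡ suc k
cdes-family₃ j k = begin
  cdes (family₃ j k)
    ≡⟨ cdes-descents 0 (applyUpTo suc j ++ down (suc j) (suc k)) ⟩
  descents 0 0 (applyUpTo suc j ++ down (suc j) (suc k))
    ≡⟨ descents-up-from-0 j (down (suc j) (suc k)) ⟩
  descents 0 j (suc j + k ∷ down (suc j) k)
    ≡⟨ descents-ascent (down (suc j) k) (s≤s (m≤m+n j k)) ⟩
  descents 0 (suc j + k) (down (suc j) k)
    ≡⟨ descents-down-end j k ⟩
  suc k
    ∎
  where open ≡-Reasoning

count : ℕ → List ℕ → ℕ
count k xs = length (filterᵇ (k ≡ᵇ_) xs)

Dcoeff≡count : ∀ Π n k → Dcoeff Π n k ≡ count k (map cdes (avoiders Π n))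
Dcoeff≡count Π n k = begin
  length (filterᵇ (λ σ → cycAvoidsAll Π σ ∧ is-k σ) (filterᵇ startsWith0 (perms n)))
    ≡⟨ cong length (filterᵇ-filterᵇ startsWith0 _ (perms n)) ⟩
  length (filterᵇ (λ σ → startsWith0 σ ∧ (cycAvoidsAll Π σ ∧ is-k σ)) (perms n))
    ≡⟨ cong length (filterᵇ-cong (λ σ → sym (∧-assoc (startsWith0 σ) _ _)) (perms n)) ⟩
  length (filterᵇ (λ σ → normalAvoider Π σ ∧ is-k σ) (perms n))
    ≡⟨ cong length (sym (filterᵇ-filterᵇ (normalAvoider Π) is-k (perms n))) ⟩
  length (filterᵇ is-k (avoiders Π n))
    ≡⟨ cong length (filterᵇ-cong (λ σ → ≡ᵇ-comm (cdes σ) k) (avoiders Π n)) ⟩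
  length (filterᵇ ((k ≡ᵇ_) ∘ cdes) (avoiders Π n))
    ≡⟨ sym (length-map cdes (filterᵇ ((k ≡ᵇ_) ∘ cdes) (avoiders Π n))) ⟩
  length (map cdes (filterᵇ ((k ≡ᵇ_) ∘ cdes) (avoiders Π n)))
    ≡⟨ cong length (sym (filterᵇ-map (k ≡ᵇ_) cdes (avoiders Π n))) ⟩
  count k (map cdes (avoiders Π n))
    ∎
  where
  open ≡-Reasoning
  is-k : List ℕ → Bool
  is-k σ = cdes σ ≡ᵇ k

count-replicate : ∀ k t v → count k (replicate t v) ≡ (if k ≡ᵇ v then t else 0)
count-replicate k zero v with k ≡ᵇ v
... | true = refl
... | false = refl
count-replicate k (suc t) v with k ≡ᵇ v in eq
... | true = cong suc (trans (count-replicate k t v) (cong (λ b → if b then t else 0) eq))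
... | false = trans (count-replicate k t v) (cong (λ b → if b then t else 0) eq)

count-rhsA : ∀ t k → count k (suc t ∷ replicate t t) ≡ rhsA (suc (suc t)) k
count-rhsA t k = begin
  count k (suc t ∷ replicate t t)
    ≡⟨ length-filterᵇ-∷ (k ≡ᵇ_) (suc t) (replicate t t) ⟩
  (if k ≡ᵇ suc t then 1 else 0) + count k (replicate t t)
    ≡⟨ cong ((if k ≡ᵇ suc t then 1 else 0) +_) (count-replicate k t t) ⟩
  (if k ≡ᵇ suc t then 1 else 0) + (if k ≡ᵇ t then t else 0)
    ≡⟨ +-comm _ (if k ≡ᵇ t then t else 0) ⟩
  rhsA (suc (suc t)) k
    ∎
  where open ≡-Reasoning

diagonal-values : ∀ (f : ℕ × ℕ → ℕ) → (∀ t → f (t , 0) ≡ suc t) →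
  (∀ i k → f (i , suc k) ≡ suc (i + k)) → ∀ t → map f (diagonal t) ≡ suc t ∷ replicate t t
diagonal-values f f-0 f-suc zero = cong [_] (f-0 0)
diagonal-values f f-0 f-suc (suc t) = cong₂ _∷_ (f-0 (suc t)) (begin
  map f (map (map₂ suc) (diagonal t))              ≡⟨ sym (map-∘ (diagonal t)) ⟩
  map (f ∘ map₂ suc) (diagonal t)                   ≡⟨ map-const-local (f ∘ map₂ suc) (diagonal t) bumped ⟩
  replicate (length (diagonal t)) (suc t)          ≡⟨ cong (λ n → replicate n (suc t)) (length-diagonal t) ⟩
  replicate (suc t) (suc t)                        ∎)
  where
  open ≡-Reasoning
  bumped : ∀ {c} → c ∈ diagonal t → f (map₂ suc c) ≡ suc t
  bumped {i , k} c∈ = trans (f-suc i k) (cong suc (∈-diagonal⁻ t c∈))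

count-rhsB : ∀ t k → count k (map (suc ∘ proj₂) (antidiagonal t)) ≡ rhsB (suc (suc t)) k
count-rhsB zero zero = refl
count-rhsB zero (suc zero) = refl
count-rhsB zero (suc (suc k)) = refl
count-rhsB (suc t) k = begin
  count k (map (suc ∘ proj₂) (map (map₂ suc) cs ++ [ (suc t , 0) ]))
    ≡⟨ cong (count k) (map-++ (suc ∘ proj₂) (map (map₂ suc) cs) [ (suc t , 0) ]) ⟩
  count k (map (suc ∘ proj₂) (map (map₂ suc) cs) ++ [ 1 ])
    ≡⟨ cong length (filter-++ (T? ∘ (k ≡ᵇ_)) (map (suc ∘ proj₂) (map (map₂ suc) cs)) [ 1 ]) ⟩
  length (filterᵇ (k ≡ᵇ_) (map (suc ∘ proj₂) (map (map₂ suc) cs)) ++ filterᵇ (k ≡ᵇ_) [ 1 ])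
    ≡⟨ length-++ (filterᵇ (k ≡ᵇ_) (map (suc ∘ proj₂) (map (map₂ suc) cs))) ⟩
  count k (map (suc ∘ proj₂) (map (map₂ suc) cs)) + count k [ 1 ]
    ≡⟨ cong (λ xs → count k xs + count k [ 1 ]) (trans (sym (map-∘ cs)) (map-∘ cs)) ⟩
  count k (map suc (map (suc ∘ proj₂) cs)) + count k [ 1 ]
    ≡⟨ shift k ⟩
  rhsB (suc (suc (suc t))) k
    ∎
  where
  open ≡-Reasoning
  cs : List (ℕ × ℕ)
  cs = antidiagonal t
  vs : List ℕ
  vs = map (suc ∘ proj₂) cs
  count-map-suc : ∀ k → count (suc k) (map suc vs) ≡ count k vs
  count-map-suc k = trans (cong length (filterᵇ-map (suc k ≡ᵇ_) suc vs)) (length-map suc (filterᵇ (k ≡ᵇ_) vs))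
  shift : ∀ k → count k (map suc vs) + count k [ 1 ] ≡ rhsB (suc (suc (suc t))) k
  shift zero = trans (cong (λ xs → length xs + 0) (filterᵇ-map (0 ≡ᵇ_) suc vs))
                     (cong (λ xs → length (map suc xs) + 0) (filterᵇ-none {p = λ _ → false} {xs = vs} (λ _ ())))
  shift (suc zero) = trans (cong (_+ 1) (count-map-suc 0)) (cong (_+ 1) (count-rhsB t 0))
  shift (suc (suc k)) = trans (+-identityʳ _) (trans (count-map-suc (suc k)) (count-rhsB t (suc k)))

cdes-avoiders₁ : ∀ t → map cdes (avoiders Π₁ (suc (suc t))) ≡ suc t ∷ replicate t t
cdes-avoiders₁ t = begin
  map cdes (avoiders Π₁ (suc (suc t)))
    ≡⟨ cong (map cdes) (avoiders₁ t) ⟩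
  map cdes (map (uncurry (family₁ ∘ suc)) (diagonal t))
    ≡⟨ sym (map-∘ (diagonal t)) ⟩
  map (cdes ∘ uncurry (family₁ ∘ suc)) (diagonal t)
    ≡⟨ diagonal-values _ cdes-family₁-0 cdes-family₁-suc t ⟩
  suc t ∷ replicate t t
    ∎
  where open ≡-Reasoning

cdes-avoiders₂ : ∀ t → map cdes (avoiders Π₂ (suc (suc t))) ≡ suc t ∷ replicate t t
cdes-avoiders₂ t = begin
  map cdes (avoiders Π₂ (suc (suc t)))
    ≡⟨ cong (map cdes) (avoiders₂ t) ⟩
  map cdes (map (uncurry family₂) (diagonal t))
    ≡⟨ sym (map-∘ (diagonal t)) ⟩
  map (cdes ∘ uncurry family₂) (diagonal t)
    ≡⟨ diagonal-values _ cdes-family₂-0 cdes-family₂-suc t ⟩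
  suc t ∷ replicate t t
    ∎
  where open ≡-Reasoning

cdes-avoiders₃ : ∀ t → map cdes (avoiders Π₃ (suc (suc t))) ≡ map (suc ∘ proj₂) (antidiagonal t)
cdes-avoiders₃ t = begin
  map cdes (avoiders Π₃ (suc (suc t)))
    ≡⟨ cong (map cdes) (avoiders₃ t) ⟩
  map cdes (map (uncurry family₃) (antidiagonal t))
    ≡⟨ sym (map-∘ (antidiagonal t)) ⟩
  map (cdes ∘ uncurry family₃) (antidiagonal t)
    ≡⟨ map-cong (uncurry cdes-family₃) (antidiagonal t) ⟩
  map (suc ∘ proj₂) (antidiagonal t)
    ∎
  where open ≡-Reasoning

mainTheorem19 : (n : ℕ) → 2 ≤ n → (k : ℕ) →
    (Dcoeff (p1234 ∷ p1342 ∷ p1423 ∷ []) n k ≡ rhsA n k)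
    × (Dcoeff (p1234 ∷ p1324 ∷ p1423 ∷ []) n k ≡ rhsA n k)
    × (Dcoeff (p1324 ∷ p1342 ∷ p1423 ∷ []) n k ≡ rhsB n k)
mainTheorem19 (suc (suc t)) (s≤s (s≤s z≤n)) k =
  trans (Dcoeff≡count Π₁ (suc (suc t)) k) (trans (cong (count k) (cdes-avoiders₁ t)) (count-rhsA t k)) ,
  trans (Dcoeff≡count Π₂ (suc (suc t)) k) (trans (cong (count k) (cdes-avoiders₂ t)) (count-rhsA t k)) ,
  trans (Dcoeff≡count Π₃ (suc (suc t)) k) (trans (cong (count k) (cdes-avoiders₃ t)) (count-rhsB t k))
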